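{- Let $x,y\ge 1$ be integers with $x \neq 3$ and $y \neq 3$. Then $\left|\mathcal{F}(K_{x,y})\right| = 1$.
   Context: All graphs are finite, undirected and simple, and are considered up to isomorphism. $K_{x,y}$ is the complete bipartite graph with parts of sizes $x$ and $y$. A Triangle-Y ($\nabla Y$) move on a graph takes a 3-cycle with vertices $a,b,c$, deletes the edges $ab,bc,ca$, and adds a new vertex $v$ with edges $av,bv,cv$. A Y-Triangle ($Y\nabla$) move is the inverse operation: for a vertex $v$ of degree three whose neighbours $a,b,c$ are pairwise non-adjacent, delete $v$ and add the edges $ab,bc,ca$. Two graphs are cousins if one is obtained from the other by a sequence of zero or more $\nabla Y$ and $Y\nabla$ moves. The family $\mathcal{F}(G)$ is the set of (isomorphism classes of) cousins of $G$, and $|\mathcal{F}(G)|$ is its size. -}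

module Defs where

open import Data.Nat using (ℕ; zero; suc; _+_; _<?_)
open import Data.Bool using (Bool; true; false; not; _∧_; _∨_; _xor_)
open import Data.Bool.Properties using (∧-comm; xor-same)
open import Data.Fin using (Fin; zero; suc; toℕ; punchIn)
open import Data.Fin.Properties using (_≟_)
open import Data.Product using (_×_; _,_)
open import Data.Sum using (_⊎_)
open import Function.Bundles using (Bijection; _⤖_)
open import Relation.Nullary using (¬_; yes; no)
open import Relation.Nullary.Decidable using (⌊_⌋)
open import Relation.Binary.PropositionalEquality using (_≡_; _≢_; refl; sym; cong; cong₂; trans)

record Graph (n : ℕ) : Set where
  field
    adj    : Fin n → Fin n → Bool
    adj-sym    : ∀ i j → adj i j ≡ adj j i
    adj-irrefl : ∀ i → adj i i ≡ false

open Graph public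

record Iso {n m : ℕ} (G : Graph n) (H : Graph m) : Set where
  field
    bij      : Fin n ⤖ Fin m
    preserve : ∀ i j → adj H (Bijection.to bij i) (Bijection.to bij j) ≡ adj G i j

eqb : ∀ {n} → Fin n → Fin n → Bool
eqb i j = ⌊ i ≟ j ⌋

eqb-sym : ∀ {n} (i j : Fin n) → eqb i j ≡ eqb j i
eqb-sym i j with i ≟ j | j ≟ i
... | yes _  | yes _  = refl
... | yes p  | no ¬q  with ¬q (sym p)
...   | ()
eqb-sym i j | no ¬p | yes q with ¬p (sym q)
...   | ()
eqb-sym i j | no _  | no _  = refl

eqb-refl : ∀ {n} (i : Fin n) → eqb i i ≡ true
eqb-refl i with i ≟ i
... | yes _ = refl
... | no ¬p with ¬p refl
...   | ()

inT : ∀ {n} → Fin n → Fin n → Fin n → Fin n → Bool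
inT a b c i = eqb i a ∨ (eqb i b ∨ eqb i c)

∧-false : ∀ x → x ∧ false ≡ false
∧-false true  = refl
∧-false false = refl

∨-false : ∀ x → x ∨ false ≡ x
∨-false true  = refl
∨-false false = refl

xor-comm' : ∀ x y → x xor y ≡ y xor x
xor-comm' true  true  = refl
xor-comm' true  false = refl
xor-comm' false true  = refl
xor-comm' false false = refl

-- Complete bipartite graph K_{x,y} on Fin (x + y):
-- vertex i is in the first part iff toℕ i < x.

inFirst : ∀ {n} → ℕ → Fin n → Bool
inFirst x i = ⌊ toℕ i <? x ⌋

K : (x y : ℕ) → Graph (x + y)
K x y = record
  { adj    = λ i j → inFirst x i xor inFirst x j
  ; adj-sym    = λ i j → xor-comm' (inFirst x i) (inFirst x j)
  ; adj-irrefl = λ i → xor-same (inFirst x i)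
  }

-- Given a triangle a,b,c of G (on Fin n), the result
-- lives on Fin (suc n): the new vertex is zero, old vertex i is suc i.
-- The edges ab, bc, ca are deleted (i.e. edges between two vertices
-- of {a,b,c}), and edges from the new vertex to a, b, c are added.

nablaY-adj : ∀ {n} → Graph n → (a b c : Fin n) → Fin (suc n) → Fin (suc n) → Bool
nablaY-adj G a b c zero    zero    = false
nablaY-adj G a b c zero    (suc j) = inT a b c j
nablaY-adj G a b c (suc i) zero    = inT a b c i
nablaY-adj G a b c (suc i) (suc j) = adj G i j ∧ not (inT a b c i ∧ inT a b c j)

nablaY-sym : ∀ {n} (G : Graph n) a b c i j → nablaY-adj G a b c i j ≡ nablaY-adj G a b c j i
nablaY-sym G a b c zero    zero    = refl
nablaY-sym G a b c zero    (suc j) = refl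
nablaY-sym G a b c (suc i) zero    = refl
nablaY-sym G a b c (suc i) (suc j) =
  cong₂ _∧_ (adj-sym G i j) (cong not (∧-comm (inT a b c i) (inT a b c j)))

nablaY-irrefl : ∀ {n} (G : Graph n) a b c i → nablaY-adj G a b c i i ≡ false
nablaY-irrefl G a b c zero    = refl
nablaY-irrefl G a b c (suc i) rewrite adj-irrefl G i = refl

nablaY : ∀ {n} → Graph n → (a b c : Fin n) → Graph (suc n)
nablaY G a b c = record
  { adj    = nablaY-adj G a b c
  ; adj-sym    = nablaY-sym G a b c
  ; adj-irrefl = nablaY-irrefl G a b c
  }

-- a, b, c span a 3-cycle (distinctness follows from irreflexivity)
IsTriangle : ∀ {n} → Graph n → (a b c : Fin n) → Set
IsTriangle G a b c = (adj G a b ≡ true) × (adj G b c ≡ true) × (adj G c a ≡ true)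

-- The result lives on
-- Fin m, old vertex punchIn v i corresponding to i : Fin m; v is deleted
-- and the edges ab, bc, ca are added.

yNabla-adj : ∀ {m} → Graph (suc m) → (v a b c : Fin (suc m)) → Fin m → Fin m → Bool
yNabla-adj G v a b c i j =
  adj G (punchIn v i) (punchIn v j)
  ∨ (inT a b c (punchIn v i) ∧ inT a b c (punchIn v j) ∧ not (eqb i j))

yNabla-sym : ∀ {m} (G : Graph (suc m)) v a b c i j → yNabla-adj G v a b c i j ≡ yNabla-adj G v a b c j i
yNabla-sym G v a b c i j =
  cong₂ _∨_ (adj-sym G (punchIn v i) (punchIn v j))
    (trans (cong (λ z → inT a b c (punchIn v i) ∧ inT a b c (punchIn v j) ∧ not z) (eqb-sym i j))
      (lemma (inT a b c (punchIn v i)) (inT a b c (punchIn v j)) (not (eqb j i))))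
  where
  lemma : ∀ x y z → x ∧ y ∧ z ≡ y ∧ x ∧ z
  lemma true  true  z = refl
  lemma true  false z = refl
  lemma false true  z = refl
  lemma false false z = refl

yNabla-irrefl : ∀ {m} (G : Graph (suc m)) v a b c i → yNabla-adj G v a b c i i ≡ false
yNabla-irrefl G v a b c i
  rewrite adj-irrefl G (punchIn v i) | eqb-refl i
  = ∧∧-false (inT a b c (punchIn v i)) (inT a b c (punchIn v i))
  where
  ∧∧-false : ∀ x y → x ∧ y ∧ false ≡ false
  ∧∧-false x y rewrite ∧-false y = ∧-false x

yNabla : ∀ {m} → Graph (suc m) → (v a b c : Fin (suc m)) → Graph m
yNabla G v a b c = record
  { adj    = yNabla-adj G v a b c
  ; adj-sym    = yNabla-sym G v a b c
  ; adj-irrefl = yNabla-irrefl G v a b c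
  }

IsY : ∀ {m} → Graph m → (v a b c : Fin m) → Set
IsY G v a b c =
  (a ≢ b) × (b ≢ c) × (a ≢ c)
  × (adj G v a ≡ true) × (adj G v b ≡ true) × (adj G v c ≡ true)
  × (∀ w → adj G v w ≡ true → (w ≡ a) ⊎ (w ≡ b) ⊎ (w ≡ c))
  × (adj G a b ≡ false) × (adj G b c ≡ false) × (adj G c a ≡ false)

-- One step: a ∇Y move, a Y∇ move, or passing to an isomorphic graph
-- (graphs are considered up to isomorphism).

data Step : ∀ {n m} → Graph n → Graph m → Set where
  iso    : ∀ {n m} {G : Graph n} {H : Graph m} → Iso G H → Step G H
  ∇Y     : ∀ {n} {G : Graph n} (a b c : Fin n) → IsTriangle G a b c → Step G (nablaY G a b c)
  Y∇     : ∀ {m} {G : Graph (suc m)} (v a b c : Fin (suc m)) → IsY G v a b c → Step G (yNabla G v a b c)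

data Cousin : ∀ {n m} → Graph n → Graph m → Set where
  here : ∀ {n} {G : Graph n} → Cousin G G
  next : ∀ {n m k} {G : Graph n} {H : Graph m} {L : Graph k} → Step G H → Cousin H L → Cousin G L

-- |F(G)| = 1 : the family of G (isomorphism classes of cousins, which
-- contains the class of G itself) has exactly one element, i.e. every
-- cousin of G is isomorphic to G.
FamilySizeOne : ∀ {n} → Graph n → Set
FamilySizeOne {n} G = ∀ {m} (H : Graph m) → Cousin G H → Iso H G

-- K_{x,y} admits no move at all: being bipartite it has no triangle, and a
-- vertex of degree three has its three neighbours in the other part, which
-- therefore has exactly three vertices; so a Y occurs only when x = 3 or
-- y = 3.  A graph admitting no move (up to isomorphism) is its own only
-- cousin.
module Submission where

open import Defs
open import Data.Nat using (ℕ; _+_; _≤_; _<_; _≮_; _<?_)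
open import Relation.Binary.PropositionalEquality using (_≢_)

open import Data.Nat.Properties using (≤-antisym; m+n≮m)
open import Data.Bool using (true; false; _xor_)
open import Data.Fin using (Fin; zero; suc; toℕ; _↑ˡ_; _↑ʳ_; splitAt)
open import Data.Fin.Properties
  using (toℕ-↑ˡ; toℕ-↑ʳ; ↑ʳ-injective; ↑ˡ-injective; splitAt⁻¹-↑ˡ; splitAt⁻¹-↑ʳ; injective⇒≤; toℕ<n)
open import Data.Product using (_,_; ∃; proj₁; proj₂)
open import Data.Sum using (_⊎_; inj₁; inj₂)
open import Data.Empty using (⊥-elim)
open import Function.Bundles using (Bijection)
open import Function.Definitions using (Injective)
import Function.Properties.Bijection as Bij
open import Relation.Nullary using (¬_; yes; no)
open import Relation.Binary.PropositionalEquality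
  using (_≡_; refl; sym; trans; cong; cong₂; subst)

private
  variable
    n m k : ℕ

module _ {G : Graph n} {H : Graph m} (I : Iso G H) where
  open Iso I
  open Bijection bij using (to; to⁻; injective; strictlySurjective)

  to∘to⁻ : ∀ j → to (to⁻ j) ≡ j
  to∘to⁻ j = proj₂ (strictlySurjective j)

  Iso-sym : Iso H G
  Iso-sym = record { bij = Bij.sym-≡ bij ; preserve = preserve⁻ }
    where
    preserve⁻ : ∀ i j → adj G (to⁻ i) (to⁻ j) ≡ adj H i j
    preserve⁻ i j = trans (sym (preserve (to⁻ i) (to⁻ j))) (cong₂ (adj H) (to∘to⁻ i) (to∘to⁻ j))

  IsTriangle-map : ∀ {a b c} → IsTriangle G a b c → IsTriangle H (to a) (to b) (to c)
  IsTriangle-map (ab , bc , ca) = trans (preserve _ _) ab , trans (preserve _ _) bc , trans (preserve _ _) ca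

  IsY-map : ∀ {v a b c} → IsY G v a b c → IsY H (to v) (to a) (to b) (to c)
  IsY-map {v} {a} {b} {c} (a≢b , b≢c , a≢c , va , vb , vc , v-nbrs , ab , bc , ca) =
    (λ e → a≢b (injective e)) , (λ e → b≢c (injective e)) , (λ e → a≢c (injective e)) ,
    pres va , pres vb , pres vc , to-v-nbrs , pres ab , pres bc , pres ca
    where
    pres : ∀ {i j r} → adj G i j ≡ r → adj H (to i) (to j) ≡ r
    pres = trans (preserve _ _)

    image : ∀ {w u} → to⁻ w ≡ u → w ≡ to u
    image {w} e = trans (sym (to∘to⁻ w)) (cong to e)

    to-v-nbrs : ∀ w → adj H (to v) w ≡ true → (w ≡ to a) ⊎ (w ≡ to b) ⊎ (w ≡ to c)
    to-v-nbrs w vw with v-nbrs (to⁻ w) (trans (sym (preserve v (to⁻ w))) (trans (cong (adj H (to v)) (to∘to⁻ w)) vw))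
    ... | inj₁ e        = inj₁ (image e)
    ... | inj₂ (inj₁ e) = inj₂ (inj₁ (image e))
    ... | inj₂ (inj₂ e) = inj₂ (inj₂ (image e))

Iso-refl : {G : Graph n} → Iso G G
Iso-refl = record { bij = Bij.refl ; preserve = λ _ _ → refl }

Iso-trans : {G : Graph n} {H : Graph m} {L : Graph k} → Iso G H → Iso H L → Iso G L
Iso-trans I J = record
  { bij      = Bij.trans (Iso.bij I) (Iso.bij J)
  ; preserve = λ i j → trans (Iso.preserve J _ _) (Iso.preserve I i j)
  }

TriangleFree : Graph n → Set
TriangleFree G = ∀ a b c → ¬ IsTriangle G a b c

YFree : Graph n → Set
YFree G = ∀ v a b c → ¬ IsY G v a b c

Iso⇒Cousin⇒Iso : {G : Graph n} → TriangleFree G → YFree G →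
                 ∀ {m k} {H : Graph m} {L : Graph k} → Iso H G → Cousin H L → Iso L G
Iso⇒Cousin⇒Iso ∇-free Y-free I here                      = I
Iso⇒Cousin⇒Iso ∇-free Y-free I (next (iso J) rest)       = Iso⇒Cousin⇒Iso ∇-free Y-free (Iso-trans (Iso-sym J) I) rest
Iso⇒Cousin⇒Iso ∇-free Y-free I (next (∇Y a b c t) _)     = ⊥-elim (∇-free _ _ _ (IsTriangle-map I t))
Iso⇒Cousin⇒Iso ∇-free Y-free I (next (Y∇ v a b c y) _)   = ⊥-elim (Y-free _ _ _ _ (IsY-map I y))

TriangleFree∧YFree⇒FamilySizeOne : {G : Graph n} → TriangleFree G → YFree G → FamilySizeOne G
TriangleFree∧YFree⇒FamilySizeOne ∇-free Y-free _ = Iso⇒Cousin⇒Iso ∇-free Y-free Iso-refl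

record HasDegree (G : Graph n) (v : Fin n) (d : ℕ) : Set where
  field
    nbr           : Fin d → Fin n
    nbr-injective : Injective _≡_ _≡_ nbr
    nbr-adjacent  : ∀ i → adj G v (nbr i) ≡ true
    nbr-complete  : ∀ w → adj G v w ≡ true → ∃ λ i → nbr i ≡ w

HasDegree⇒≤ : {G : Graph n} {v : Fin n} {d e : ℕ} → HasDegree G v d → HasDegree G v e → d ≤ e
HasDegree⇒≤ D E = injective⇒≤ {f = f} f-injective
  where
  open HasDegree
  f : Fin _ → Fin _
  f i = proj₁ (nbr-complete E (nbr D i) (nbr-adjacent D i))

  nbr-f : ∀ i → nbr E (f i) ≡ nbr D i
  nbr-f i = proj₂ (nbr-complete E (nbr D i) (nbr-adjacent D i))

  f-injective : Injective _≡_ _≡_ f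
  f-injective {i} {j} e = nbr-injective D (trans (sym (nbr-f i)) (trans (cong (nbr E) e) (nbr-f j)))

HasDegree-unique : {G : Graph n} {v : Fin n} {d e : ℕ} → HasDegree G v d → HasDegree G v e → d ≡ e
HasDegree-unique D E = ≤-antisym (HasDegree⇒≤ D E) (HasDegree⇒≤ E D)

IsY⇒HasDegree3 : {G : Graph n} {v a b c : Fin n} → IsY G v a b c → HasDegree G v 3
IsY⇒HasDegree3 {G = G} {v} {a} {b} {c} (a≢b , b≢c , a≢c , va , vb , vc , v-nbrs , _) = record
  { nbr           = abc
  ; nbr-injective = abc-injective
  ; nbr-adjacent  = λ { zero → va ; (suc zero) → vb ; (suc (suc zero)) → vc }
  ; nbr-complete  = complete
  }
  where
  abc : Fin 3 → Fin _
  abc zero             = a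
  abc (suc zero)       = b
  abc (suc (suc zero)) = c

  abc-injective : Injective _≡_ _≡_ abc
  abc-injective {zero}             {zero}             _ = refl
  abc-injective {zero}             {suc zero}         e = ⊥-elim (a≢b e)
  abc-injective {zero}             {suc (suc zero)}   e = ⊥-elim (a≢c e)
  abc-injective {suc zero}         {zero}             e = ⊥-elim (a≢b (sym e))
  abc-injective {suc zero}         {suc zero}         _ = refl
  abc-injective {suc zero}         {suc (suc zero)}   e = ⊥-elim (b≢c e)
  abc-injective {suc (suc zero)}   {zero}             e = ⊥-elim (a≢c (sym e))
  abc-injective {suc (suc zero)}   {suc zero}         e = ⊥-elim (b≢c (sym e))
  abc-injective {suc (suc zero)}   {suc (suc zero)}   _ = refl

  complete : ∀ w → adj G v w ≡ true → ∃ λ i → abc i ≡ w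
  complete w vw with v-nbrs w vw
  ... | inj₁ e        = zero , sym e
  ... | inj₂ (inj₁ e) = suc zero , sym e
  ... | inj₂ (inj₂ e) = suc (suc zero) , sym e

xor-cycle₃ : ∀ p q r → p xor q ≡ true → q xor r ≡ true → r xor p ≡ false
xor-cycle₃ true  true  _     ()
xor-cycle₃ true  false true  _  _  = refl
xor-cycle₃ true  false false _  ()
xor-cycle₃ false true  true  _  ()
xor-cycle₃ false true  false _  _  = refl
xor-cycle₃ false false _     ()

K-triangleFree : ∀ x y → TriangleFree (K x y)
K-triangleFree x y a b c (ab , bc , ca)
  with trans (sym ca) (xor-cycle₃ (inFirst x a) (inFirst x b) (inFirst x c) ab bc)
... | ()

inFirst-true : ∀ x (i : Fin n) → toℕ i < x → inFirst x i ≡ true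
inFirst-true x i i<x with toℕ i <? x
... | yes _   = refl
... | no i≮x = ⊥-elim (i≮x i<x)

inFirst-false : ∀ x (i : Fin n) → ¬ toℕ i < x → inFirst x i ≡ false
inFirst-false x i i≮x with toℕ i <? x
... | yes i<x = ⊥-elim (i≮x i<x)
... | no _    = refl

module _ (x y : ℕ) where

  inFirst-↑ˡ : (i : Fin x) → inFirst x (i ↑ˡ y) ≡ true
  inFirst-↑ˡ i = inFirst-true x (i ↑ˡ y) (subst (_< x) (sym (toℕ-↑ˡ i y)) (toℕ<n i))

  inFirst-↑ʳ : (j : Fin y) → inFirst x (x ↑ʳ j) ≡ false
  inFirst-↑ʳ j = inFirst-false x (x ↑ʳ j) (subst (_≮ x) (sym (toℕ-↑ʳ x j)) (m+n≮m x (toℕ j)))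

  ↑ˡ⊎↑ʳ : (w : Fin (x + y)) → (∃ λ i → i ↑ˡ y ≡ w) ⊎ (∃ λ j → x ↑ʳ j ≡ w)
  ↑ˡ⊎↑ʳ w with splitAt x w in eq
  ... | inj₁ i = inj₁ (i , splitAt⁻¹-↑ˡ eq)
  ... | inj₂ j = inj₂ (j , splitAt⁻¹-↑ʳ eq)

  K-degree-↑ˡ : (i : Fin x) → HasDegree (K x y) (i ↑ˡ y) y
  K-degree-↑ˡ i = record
    { nbr           = x ↑ʳ_
    ; nbr-injective = ↑ʳ-injective x _ _
    ; nbr-adjacent  = λ j → cong₂ _xor_ (inFirst-↑ˡ i) (inFirst-↑ʳ j)
    ; nbr-complete  = complete
    }
    where
    complete : ∀ w → adj (K x y) (i ↑ˡ y) w ≡ true → ∃ λ j → x ↑ʳ j ≡ w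
    complete w iw with ↑ˡ⊎↑ʳ w
    ... | inj₂ j∼w        = j∼w
    ... | inj₁ (i′ , refl) with trans (sym iw) (cong₂ _xor_ (inFirst-↑ˡ i) (inFirst-↑ˡ i′))
    ...   | ()

  K-degree-↑ʳ : (j : Fin y) → HasDegree (K x y) (x ↑ʳ j) x
  K-degree-↑ʳ j = record
    { nbr           = _↑ˡ y
    ; nbr-injective = ↑ˡ-injective y _ _
    ; nbr-adjacent  = λ i → cong₂ _xor_ (inFirst-↑ʳ j) (inFirst-↑ˡ i)
    ; nbr-complete  = complete
    }
    where
    complete : ∀ w → adj (K x y) (x ↑ʳ j) w ≡ true → ∃ λ i → i ↑ˡ y ≡ w
    complete w jw with ↑ˡ⊎↑ʳ w
    ... | inj₁ i∼w        = i∼w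
    ... | inj₂ (j′ , refl) with trans (sym jw) (cong₂ _xor_ (inFirst-↑ʳ j) (inFirst-↑ʳ j′))
    ...   | ()

  K-degree : ∀ v → HasDegree (K x y) v y ⊎ HasDegree (K x y) v x
  K-degree v with ↑ˡ⊎↑ʳ v
  ... | inj₁ (i , refl) = inj₁ (K-degree-↑ˡ i)
  ... | inj₂ (j , refl) = inj₂ (K-degree-↑ʳ j)

  K-YFree : x ≢ 3 → y ≢ 3 → YFree (K x y)
  K-YFree x≢3 y≢3 v a b c Y with K-degree v
  ... | inj₁ deg-y = y≢3 (HasDegree-unique deg-y (IsY⇒HasDegree3 Y))
  ... | inj₂ deg-x = x≢3 (HasDegree-unique deg-x (IsY⇒HasDegree3 Y))

theorem3 : (x y : ℕ) → 1 ≤ x → 1 ≤ y → x ≢ 3 → y ≢ 3 → FamilySizeOne (K x y)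
theorem3 x y _ _ x≢3 y≢3 = TriangleFree∧YFree⇒FamilySizeOne (K-triangleFree x y) (K-YFree x y x≢3 y≢3)
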